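{- In the instantiation of a template-acyclic directed parametric graph template, consider a path $P_{uv}$ from a vertex $u$ to a vertex $v$ and a path $P_{wz}$ from a vertex $w$ to a vertex $z$, where $T(v)=T(z)$. If $T(v)=T(u)$ or $T(v)$ is an ancestor of $T(u)$, then: if $u$ and $w$ belong to the same instance of the same template, then $v$ and $z$ also belong to the same instance of the same template.
   Context: A parametric graph template $\mathcal{G}=(G,\mathcal{T},\mathcal{P})$ consists of a directed template graph $G=(V,E)$, a list of templates $T_0,\dots,T_{k-1}$ with $\emptyset\neq T_i\subseteq V$, and positive integer parameters $P_0,\dots,P_{k-1}$. For $i\neq j$, either $T_i\cap T_j=\emptyset$, $T_i\subsetneq T_j$, or $T_j\subsetneq T_i$; the root template is $T_0=V$ with $P_0=1$. Inclusion induces a rooted template tree. For $v\in V$, $T(v)$ is the smallest template containing $v$. No skipping: for every edge $(u,v)$ with $T(u)\neq T(v)$, one of $T(u),T(v)$ is the parent of the other. The instantiation: while more than one template remains, pick a leaf template $T_i\neq T_0$; replace each $v\in T_i$ (in $V$ and every template containing it) by $P_i$ copies $v_1,\dots,v_{P_i}$ (instances of $v$); replace each edge $(u,v)$ with both endpoints in $T_i$ by $(u_j,v_j)$, each edge $(u,v)$ with only $u\in T_i$ by $(u_j,v)$, and symmetrically, $j=1,\dots,P_i$; delete $T_i,P_i$. For each $j$, the vertices obtained as $j$-th copies when processing $T_i$ form an instance of $T_i$; instances inherit the tree structure of templates. A vertex $x$ of the instantiation belongs to the deepest instance containing it, and $T(x)$ is the template of that instance. A template-cycle is a directed path $p_1,\dots,p_r$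 in $G$ with indices $a<b<c$ such that $T(p_a)=T(p_c)\neq T(p_b)$; $\mathcal{G}$ is template-acyclic if it has none. -}

module Defs where

open import Data.Nat using (ℕ; suc; _<_)
open import Data.Fin using (Fin; zero; suc; inject₁) renaming (_<_ to _<ᶠ_)
open import Data.Fin.Subset using (Subset; _∈_; _⊆_; _⊂_; ⊤; Empty; Nonempty; _∩_)
open import Data.Product using (Σ; _×_; _,_; ∃; ∃-syntax)
open import Data.Sum using (_⊎_)
open import Relation.Binary.PropositionalEquality using (_≡_; _≢_)
open import Relation.Nullary using (¬_)

record PGT : Set₁ where
  field
    n k : ℕ
    E   : Fin n → Fin n → Set
    T   : Fin (suc k) → Subset n
    P   : Fin (suc k) → ℕ

  -- T i is the smallest template containing v  (i.e. T(v) = T i)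
  IsT : Fin n → Fin (suc k) → Set
  IsT v i = v ∈ T i × (∀ j → v ∈ T j → T i ⊆ T j)

  Parent : Fin (suc k) → Fin (suc k) → Set
  Parent i j = T i ⊂ T j × (∀ l → T i ⊂ T l → ¬ (T l ⊂ T j))

  Ancestor : Fin (suc k) → Fin (suc k) → Set
  Ancestor j i = T i ⊂ T j

  field
    nonempty : ∀ i → Nonempty (T i)
    laminar  : ∀ i j → i ≢ j → Empty (T i ∩ T j) ⊎ (T i ⊂ T j ⊎ T j ⊂ T i)
    root     : T zero ≡ ⊤
    rootP    : P zero ≡ 1
    positive : ∀ i → 0 < P i
    noSkip   : ∀ u v → E u v → ∀ i j → IsT u i → IsT v j → i ≢ j →
               Parent i j ⊎ Parent j i

  IsWalkG : (r : ℕ) → (Fin (suc r) → Fin n) → Set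
  IsWalkG r p = ∀ (i : Fin r) → E (p (inject₁ i)) (p (suc i))

  TemplateCycle : Set
  TemplateCycle =
    Σ ℕ λ r → Σ (Fin (suc r) → Fin n) λ p → IsWalkG r p ×
    Σ (Fin (suc r)) λ a → Σ (Fin (suc r)) λ b → Σ (Fin (suc r)) λ c →
      a <ᶠ b × b <ᶠ c ×
      Σ (Fin (suc k)) λ i → Σ (Fin (suc k)) λ j →
        IsT (p a) i × IsT (p c) i × IsT (p b) j × i ≢ j

  TemplateAcyclic : Set
  TemplateAcyclic = ¬ TemplateCycle

  -- A vertex is an instance of a
  -- template-graph vertex `base`, together with a copy number
  -- idx i ∈ Fin (P i) for every template T i containing `base`
  -- (entries idx i with base ∉ T i are irrelevant junk).

  record IVertex : Set where
    constructor ivertex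
    field
      base : Fin n
      idx  : (i : Fin (suc k)) → Fin (P i)

  open IVertex public

  IEdge : IVertex → IVertex → Set
  IEdge x y = E (base x) (base y) ×
              (∀ i → base x ∈ T i → base y ∈ T i → idx x i ≡ idx y i)

  data IPath : IVertex → IVertex → Set where
    []  : ∀ {x} → IPath x x
    _∷_ : ∀ {x y z} → IEdge x y → IPath y z → IPath x z

  IsTI : IVertex → Fin (suc k) → Set
  IsTI x i = IsT (base x) i

  BelongsTo : IVertex → Fin (suc k) → ((j : Fin (suc k)) → Fin (P j)) → Set
  BelongsTo x i γ = IsTI x i × (∀ j → T i ⊆ T j → idx x j ≡ γ j)

  SameInstance : IVertex → IVertex → Set
  SameInstance x y = ∃[ i ] (BelongsTo x i (idx x) × BelongsTo y i (idx x))

  SameT : IVertex → IVertex → Set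
  SameT x y = ∃[ i ] (IsTI x i × IsTI y i)

  EqOrAncestor : IVertex → IVertex → Set
  EqOrAncestor y x = ∃[ i ] ∃[ j ] (IsTI x i × IsTI y j × (j ≡ i ⊎ Ancestor j i))

{-# OPTIONS --safe #-}
-- Copy numbers only change where a path crosses the boundary of a template.
-- By no-skipping, a walk of G that leaves T s does so from a vertex of
-- template T s, and if it ever came back it would enter T s at a vertex of
-- template T s again, with a vertex of another template in between: a
-- template-cycle.  So along any path of the instantiation between two vertices
-- of T s the copy number for T s is constant.  Every template containing
-- T(v) = T(z) contains T(u) = T(w), so u, w, v, z all carry the same copy
-- numbers there.
module Submission where

open import Defs
open import Data.Nat using (ℕ; zero; suc; z≤n; s≤s)
open import Data.Fin using (Fin; zero; suc; fromℕ; _≟_)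
open import Data.Fin.Properties using (any?)
open import Data.Fin.Subset using (_∈_; _∉_; _⊆_; _⊂_)
open import Data.Fin.Subset.Properties using (_∈?_; _⊂?_; ∈⊤; ⊆-trans; ⊆-reflexive; x∈p∩q⁺)
open import Data.Fin.Subset.Induction using (⊂-wellFounded)
open import Induction.WellFounded using (Acc; acc)
open import Data.Product using (∃; ∃₂; _×_; _,_; proj₁; proj₂)
open import Data.Sum using (_⊎_; inj₁; inj₂; swap)
open import Data.Empty using (⊥-elim)
open import Function using (id; _∘_)
open import Relation.Nullary using (yes; no)
open import Relation.Nullary.Decidable using (_×-dec_)
open import Relation.Binary.PropositionalEquality
  using (_≡_; _≢_; refl; sym; trans; cong; subst; module ≡-Reasoning)

module _ (G : PGT) where
  open PGT G

  ⊆-or-⊃ : ∀ {x} i j → x ∈ T i → x ∈ T j → T i ⊆ T j ⊎ T j ⊂ T i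
  ⊆-or-⊃ i j x∈i x∈j with i ≟ j
  ... | yes refl = inj₁ id
  ... | no i≢j with laminar i j i≢j
  ... | inj₁ disjoint    = ⊥-elim (disjoint (_ , x∈p∩q⁺ (x∈i , x∈j)))
  ... | inj₂ (inj₁ i⊂j) = inj₁ (proj₁ i⊂j)
  ... | inj₂ (inj₂ j⊂i) = inj₂ j⊂i

  templateOf : ∀ v → ∃ (IsT v)
  templateOf v = descend zero (subst (v ∈_) (sym root) ∈⊤) (⊂-wellFounded (T zero))
    where
    descend : ∀ i → v ∈ T i → Acc _⊂_ (T i) → ∃ (IsT v)
    descend i v∈i (acc smaller) with any? (λ j → (v ∈? T j) ×-dec (T j ⊂? T i))
    ... | yes (j , v∈j , j⊂i) = descend j v∈j (smaller j⊂i)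
    ... | no none = i , v∈i , minimal
      where
      minimal : ∀ j → v ∈ T j → T i ⊆ T j
      minimal j v∈j with ⊆-or-⊃ i j v∈i v∈j
      ... | inj₁ i⊆j = i⊆j
      ... | inj₂ j⊂i = ⊥-elim (none (j , v∈j , j⊂i))

  -- The hypothesis is what no-skipping says about an edge between p and q, in
  -- either direction.
  boundary-IsT : ∀ {p q s} →
                 (∀ {a b} → IsT p a → IsT q b → a ≢ b → Parent a b ⊎ Parent b a) →
                 p ∈ T s → q ∉ T s → IsT p s
  boundary-IsT {p} {q} {s} noSkip′ p∈s q∉s
    with templateOf p | templateOf q
  ... | a , p-a@(p∈a , a-min) | b , q-b@(q∈b , _) = parentOf (noSkip′ p-a q-b a≢b)
    where
    a≢b : a ≢ b
    a≢b refl = q∉s (a-min s p∈s q∈b)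

    parentOf : Parent a b ⊎ Parent b a → IsT p s
    parentOf (inj₂ (b⊂a , _)) = ⊥-elim (q∉s (a-min s p∈s (proj₁ b⊂a q∈b)))
    parentOf (inj₁ (a⊂b , nothing-between)) with ⊆-or-⊃ s a p∈s p∈a
    ... | inj₁ s⊆a = p∈s , λ j p∈j → ⊆-trans s⊆a (a-min j p∈j)
    ... | inj₂ a⊂s with ⊆-or-⊃ b s (proj₁ a⊂b p∈a) p∈s
    ...   | inj₁ b⊆s = ⊥-elim (q∉s (b⊆s q∈b))
    ...   | inj₂ s⊂b = ⊥-elim (nothing-between s a⊂s s⊂b)

  exit-IsT : ∀ {p q s} → E p q → p ∈ T s → q ∉ T s → IsT p s
  exit-IsT e = boundary-IsT (noSkip _ _ e _ _)

  entry-IsT : ∀ {p q s} → E q p → q ∉ T s → p ∈ T s → IsT p s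
  entry-IsT e q∉s p∈s =
    boundary-IsT (λ p-a q-b a≢b → swap (noSkip _ _ e _ _ q-b p-a (a≢b ∘ sym))) p∈s q∉s

  data Walk : ℕ → Fin n → Fin n → Set where
    []  : ∀ {a} → Walk zero a a
    _∷_ : ∀ {r a b c} → E a b → Walk r b c → Walk (suc r) a c

  vertex : ∀ {r a b} → Walk r a b → Fin (suc r) → Fin n
  vertex {a = a} _ zero    = a
  vertex (_ ∷ w)  (suc i) = vertex w i

  vertex-last : ∀ {r a b} (w : Walk r a b) → vertex w (fromℕ r) ≡ b
  vertex-last []      = refl
  vertex-last (_ ∷ w) = vertex-last w

  vertex-isWalk : ∀ {r a b} (w : Walk r a b) → IsWalkG r (vertex w)
  vertex-isWalk (e ∷ _) zero    = e
  vertex-isWalk (_ ∷ w) (suc i) = vertex-isWalk w i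

  IPath⇒Walk : ∀ {x y} → IPath x y → ∃ λ r → Walk r (base x) (base y)
  IPath⇒Walk []      = zero , []
  IPath⇒Walk (e ∷ p) with IPath⇒Walk p
  ... | r , w = suc r , proj₁ e ∷ w

  walk-into-IsT : ∀ {r a c s} → Walk r a c → a ∉ T s → c ∈ T s →
                  ∃₂ λ r′ y → Walk (suc r′) a y × IsT y s
  walk-into-IsT [] a∉s a∈s = ⊥-elim (a∉s a∈s)
  walk-into-IsT {s = s} (_∷_ {b = b} e w) a∉s c∈s with b ∈? T s
  ... | yes b∈s = zero , b , e ∷ [] , entry-IsT e a∉s b∈s
  ... | no b∉s with walk-into-IsT w b∉s c∈s
  ...   | r , y , w′ , y-s = suc r , y , e ∷ w′ , y-s

  walk⇒TemplateCycle : ∀ {r a b y s t} → E a b → Walk (suc r) b y →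
                       IsT a s → IsT b t → IsT y s → s ≢ t → TemplateCycle
  walk⇒TemplateCycle {r} {s = s} {t} e w a-s b-t y-s s≢t =
    suc (suc r) , vertex (e ∷ w) , vertex-isWalk (e ∷ w) ,
    zero , suc zero , fromℕ (suc (suc r)) , s≤s z≤n , s≤s (s≤s z≤n) ,
    s , t , a-s , subst (λ x → IsT x s) (sym (vertex-last (e ∷ w))) y-s , b-t , s≢t

  module _ (acyclic : TemplateAcyclic) where

    no-return : ∀ {r a b c s} → E a b → a ∈ T s → b ∉ T s → Walk r b c → c ∉ T s
    no-return {b = b} e a∈s b∉s w c∈s with walk-into-IsT w b∉s c∈s | templateOf b
    ... | _ , _ , w′ , y-s | t , b-t =
      acyclic (walk⇒TemplateCycle e w′ (exit-IsT e a∈s b∉s) b-t y-s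
                 λ { refl → b∉s (proj₁ b-t) })

    IPath⇒idx≡ : ∀ {x y} s → IPath x y → base x ∈ T s → base y ∈ T s → idx x s ≡ idx y s
    IPath⇒idx≡ s [] _ _ = refl
    IPath⇒idx≡ s (_∷_ {y = x₁} e p) x∈s y∈s with base x₁ ∈? T s
    ... | yes x₁∈s = trans (proj₂ e s x∈s x₁∈s) (IPath⇒idx≡ s p x₁∈s y∈s)
    ... | no x₁∉s  = ⊥-elim (no-return (proj₁ e) x∈s x₁∉s (proj₂ (IPath⇒Walk p)) y∈s)

  EqOrAncestor⇒⊆ : ∀ {u v i m} → EqOrAncestor v u → IsTI u i → IsTI v m → T i ⊆ T m
  EqOrAncestor⇒⊆ (i′ , m′ , u-i′ , v-m′ , m′≽i′) (_ , i-min) (v∈m , _) =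
    ⊆-trans (i-min i′ (proj₁ u-i′)) (⊆-trans (⊇ m′≽i′) (proj₂ v-m′ _ v∈m))
    where
    ⊇ : m′ ≡ i′ ⊎ Ancestor m′ i′ → T i′ ⊆ T m′
    ⊇ (inj₁ m′≡i′) = ⊆-reflexive (cong T (sym m′≡i′))
    ⊇ (inj₂ i′⊂m′) = proj₁ i′⊂m′

open PGT

lemma6 : (G : PGT) → TemplateAcyclic G →
    (u v w z : IVertex G) → IPath G u v → IPath G w z →
    SameT G v z → EqOrAncestor G v u →
    SameInstance G u w → SameInstance G v z
lemma6 G acyclic u v w z u⇝v w⇝z (m , v-m , z-m) v≽u (i , (u-i , _) , (w-i , w≈u)) =
  m , (v-m , λ _ _ → refl) , (z-m , z≈v)
  where
  open ≡-Reasoning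

  z≈v : ∀ j → T G m ⊆ T G j → idx z j ≡ idx v j
  z≈v j m⊆j = begin
    idx z j ≡⟨ sym (IPath⇒idx≡ G acyclic j w⇝z (i⊆j (proj₁ w-i)) (m⊆j (proj₁ z-m))) ⟩
    idx w j ≡⟨ w≈u j i⊆j ⟩
    idx u j ≡⟨ IPath⇒idx≡ G acyclic j u⇝v (i⊆j (proj₁ u-i)) (m⊆j (proj₁ v-m)) ⟩
    idx v j ∎
    where
    i⊆j : T G i ⊆ T G j
    i⊆j = ⊆-trans (EqOrAncestor⇒⊆ G {u} {v} v≽u u-i v-m) m⊆j
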